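{- Let $m,r$ be relatively prime positive integers with $2\le m\le 12$, let $s=\gcd(r-1,m)$, $t=m/s$, and let $n$ be the smallest positive integer with $r^n\equiv 1\pmod m$. Suppose $n=2$ and $\gcd(n,t)=\gcd(s,t)=1$. Then the group $G_{m,r}$ can be embedded in (the multiplicative group of) a division ring if and only if $G_{m,r}$ is isomorphic to one of $\mathbb{Z}/4\mathbb{Z}$, $\mathrm{Dic}_{12}$, $\mathrm{Dic}_{20}$.
   Context: $G_{m,r}$ is the group generated by $a,b$ with relations $a^m=1$, $b^n=a^t$, $bab^{ -1}=a^r$ (of order $mn$). $\mathrm{Dic}_{4k}=\langle a,b\mid a^{2k}=1,b^2=a^k,bab^{ -1}=a^{ -1}\rangle$ denotes the dicyclic group of order $4k$. -}

module Defs where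

open import Level using (Level; 0ℓ; _⊔_) renaming (suc to lsuc)
open import Data.Nat using (ℕ; zero; suc; _+_; _*_; _∸_; _^_; _<_; NonZero; ≢-nonZero; ≢-nonZero⁻¹)
open import Data.Nat.DivMod using (_/_; _%_; _mod_)
open import Data.Nat.GCD using (gcd; gcd[m,n]≢0)
open import Data.Fin using (Fin; toℕ)
open import Data.Product using (Σ; ∃; _×_; _,_)
open import Data.Sum using (inj₂)
open import Relation.Nullary using (¬_)
open import Relation.Binary.PropositionalEquality using (_≡_; _≢_)
open import Function.Definitions using (Injective; Bijective)
open import Algebra.Bundles using (Ring)
open import Algebra.Bundles.Raw using (RawMonoid)

sOf : ℕ → ℕ → ℕ
sOf m r = gcd (r ∸ 1) m

tOf : (m r : ℕ) → .{{NonZero m}} → ℕ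
tOf m r = _/_ m (sOf m r) {{≢-nonZero (gcd[m,n]≢0 (r ∸ 1) m (inj₂ (≢-nonZero⁻¹ m)))}}

IsMultOrder : (m r n : ℕ) → .{{NonZero m}} → Set
IsMultOrder m r n =
  0 < n × (r ^ n) % m ≡ 1 % m × (∀ k → 0 < k → k < n → ¬ ((r ^ k) % m ≡ 1 % m))

-- Groups given by the presentation
--   ⟨ a , b | a^m = 1 , b^n = a^t , b a b⁻¹ = a^r ⟩
-- (with r^n ≡ 1 and t(r-1) ≡ 0 mod m this group has order m n).
-- Every element has a unique normal form a^i b^j (0 ≤ i < m, 0 ≤ j < n);
-- we realise the group on these normal forms.  Using b^j a^k = a^(k r^j) b^j
-- and b^(j+l) = a^t b^(j+l-n) when j+l ≥ n:
--   (a^i b^j)(a^k b^l) = a^(i + k r^j + ⌊(j+l)/n⌋ t) b^((j+l) mod n).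

Meta : (m n t r : ℕ) → .{{NonZero m}} → .{{NonZero n}} → RawMonoid 0ℓ 0ℓ
Meta m n t r = record
  { Carrier = Fin m × Fin n
  ; _≈_     = _≡_
  ; _∙_     = mul
  ; ε       = (0 mod m , 0 mod n)
  }
  where
  mul : Fin m × Fin n → Fin m × Fin n → Fin m × Fin n
  mul (i , j) (k , l) =
    ( (toℕ i + toℕ k * r ^ toℕ j + ((toℕ j + toℕ l) / n) * t) mod m
    , (toℕ j + toℕ l) mod n )

G : (m r : ℕ) → .{{NonZero m}} → RawMonoid 0ℓ 0ℓ
G m r = Meta m 2 (tOf m r) r

-- Dic_{4k} = ⟨ a , b | a^{2k} = 1 , b^2 = a^k , b a b⁻¹ = a^{-1} ⟩,
-- with a^{-1} = a^{2k-1}.  (Defined for k ≥ 1.)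
Dic4 : (k : ℕ) → .{{NonZero k}} → RawMonoid 0ℓ 0ℓ
Dic4 (suc k) = Meta (2 * suc k) 2 (suc k) (2 * suc k ∸ 1)

Dic12 : RawMonoid 0ℓ 0ℓ
Dic12 = Dic4 3

Dic20 : RawMonoid 0ℓ 0ℓ
Dic20 = Dic4 5

Z4 : RawMonoid 0ℓ 0ℓ
Z4 = record
  { Carrier = Fin 4
  ; _≈_     = _≡_
  ; _∙_     = λ i j → (toℕ i + toℕ j) mod 4
  ; ε       = 0 mod 4
  }

_≅_ : RawMonoid 0ℓ 0ℓ → RawMonoid 0ℓ 0ℓ → Set
A ≅ B = Σ (A.Carrier → B.Carrier) λ f →
          Bijective A._≈_ B._≈_ f
        × (∀ x y → f (x A.∙ y) B.≈ (f x B.∙ f y))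
        × f A.ε B.≈ B.ε
  where
  module A = RawMonoid A
  module B = RawMonoid B

record DivisionRing (c ℓ : Level) : Set (lsuc (c ⊔ ℓ)) where
  field
    ring : Ring c ℓ
  open Ring ring public
    using (Carrier; _≈_; _+_; -_; 0#; 1#)
    renaming (_*_ to _·_)
  field
    0≉1     : ¬ (0# ≈ 1#)
    inverse : ∀ x → ¬ (x ≈ 0#) → ∃ λ y → (x · y ≈ 1#) × (y · x ≈ 1#)

-- An embedding of a group G into the multiplicative group of a division
-- ring D: an injective map that is multiplicative and sends 1 to 1
-- (its image then lies in the unit group D^×).
EmbeddingInto : RawMonoid 0ℓ 0ℓ → DivisionRing 0ℓ 0ℓ → Set
EmbeddingInto Gr D = Σ (Gr.Carrier → D.Carrier) λ f →
    Injective Gr._≈_ D._≈_ f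
  × (∀ x y → f (x Gr.∙ y) D.≈ (f x D.· f y))
  × f Gr.ε D.≈ D.1#
  where
  module Gr = RawMonoid Gr
  module D = DivisionRing D

EmbedsInDivisionRing : RawMonoid 0ℓ 0ℓ → Set₁
EmbedsInDivisionRing Gr = Σ (DivisionRing 0ℓ 0ℓ) λ D → EmbeddingInto Gr D

-- After reducing r modulo m, a finite computation shows that the order and gcd hypotheses leave
-- only r ≡ -1 with t ≡ 0 (mod m), where G_{m,r} is dihedral, and (m, r) ∈ {(6,5), (10,9), (12,5)},
-- where G_{m,r} is Dic₁₂, Dic₂₀ and C₃ ⋊ C₈. As 1 and -1 are the only square roots of 1 in a
-- division ring, a group with two distinct involutions does not embed in one. Neither does
-- C₃ ⋊ C₈ = ⟨w, b | w³ = b⁸ = 1, b w b⁻¹ = w²⟩: with c = b², the element y = (w + c) b would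
-- satisfy y² = (w + c)(w² + c) c = -c² = 1 without commuting with b. Conversely ℤ/4ℤ, Dic₁₂ and
-- Dic₂₀ lie in the Hamilton quaternions over ℚ(√5), a division ring as √5 is irrational and
-- ℚ(√5) is real.

module Submission where

open import Level using (Level; 0ℓ)
open import Data.Empty using (⊥; ⊥-elim)
open import Data.Fin as Fin using (Fin; zero; suc; toℕ; fromℕ<)
import Data.Fin.Properties as Fin
open import Data.Integer as ℤ using (+_; +[1+_]; +0; -[1+_]; ∣_∣)
import Data.Integer.Properties as ℤ
open import Data.Integer.Solver using () renaming (module +-*-Solver to ℤ-Solver)
open import Data.Nat as ℕ using (ℕ; zero; suc; _∸_; _≤_; _<_; s≤s; z≤n; NonZero)
import Data.Nat.Properties as ℕ
open import Data.Nat.Coprimality using (1-coprimeTo) renaming (sym to coprime-sym)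
open import Data.Nat.Divisibility using (_∣_; divides; ∣m∣n⇒∣m+n; ∣n⇒∣m*n; ∣m+n∣m⇒∣n)
open import Data.Nat.DivMod using (_%_; _/_; _mod_; %-distribˡ-+; %-distribˡ-*; m%n<n; m%n%n≡m%n; m≡m%n+[m/n]*n; /-congʳ; n%n≡0; m*n%n≡0)
open import Data.Nat.GCD using (gcd; module GCD; gcd-GCD; gcd[m,n]∣m; gcd[m,n]∣n; gcd-greatest; gcd[m,n]≢0)
open import Data.Nat.Induction using (<-rec)
open import Data.Nat.Primality using (Prime; prime?; euclidsLemma; prime⇒nonZero; prime⇒nonTrivial)
open import Data.Nat.Solver using () renaming (module +-*-Solver to ℕ-Solver)
open import Data.Product using (∃; _×_; _,_; proj₁; proj₂)
open import Data.Product.Properties using (≡-dec)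
open import Data.Rational as ℚ using (ℚ; mkℚ; mkℚ+; 0ℚ; 1ℚ; 1/_; ↥_; ↧_; toℚᵘ; NonNegative; Positive)
import Data.Rational.Properties as ℚ
import Algebra.Properties.Group ℚ.+-0-group as ℚ+
open import Data.Rational.Solver using () renaming (module +-*-Solver to ℚ-Solver)
import Data.Rational.Unnormalised.Properties as ℚᵘ
open import Data.Sum using (_⊎_; inj₁; inj₂; [_,_]′)
open import Data.Vec using (Vec; lookup; tabulate)
open import Data.Vec.N-ary using (N-ary)
open import Function using (id; _∘′_)
open import Function.Construct.Identity using (bijective)
open import Relation.Binary.PropositionalEquality using (_≡_; _≢_; refl; cong; cong₂; subst; isEquivalence; module ≡-Reasoning)
import Relation.Binary.PropositionalEquality as ≡
open import Relation.Nullary using (¬_; Dec; yes; no; contradiction)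
open import Relation.Binary.Definitions using (Decidable)
open import Relation.Nullary.Decidable using (map′; from-yes; _×-dec_; _⊎-dec_; _→-dec_; ¬?)
open import Algebra.Bundles using (Ring; CommutativeRing)
open import Algebra.Bundles.Raw using (RawMonoid)
open import Algebra.Structures using (IsRing; IsCommutativeRing)
open import Algebra.Solver.Ring.AlmostCommutativeRing using (fromCommutativeRing)
import Algebra.Solver.Ring.Simple as RingSolver

open import Defs

-- The irrationality of √p

fromℕ : ℕ → ℚ
fromℕ n = mkℚ+ n 1 (coprime-sym (1-coprimeTo n))

module _ {p : ℕ} (p-prime : Prime p) where

  private instance
    p≢0 = prime⇒nonZero p-prime
    p>1 = prime⇒nonTrivial p-prime

  private
    p∣x*x⇒p∣x : ∀ x → p ∣ x ℕ.* x → p ∣ x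
    p∣x*x⇒p∣x x p∣x*x = [ id , id ]′ (euclidsLemma x x p-prime p∣x*x)

    x*x≡p*y*y⇒p∣x : ∀ x y → x ℕ.* x ≡ p ℕ.* (y ℕ.* y) → p ∣ x
    x*x≡p*y*y⇒p∣x x y eq = p∣x*x⇒p∣x x (divides (y ℕ.* y) (≡.trans eq (ℕ.*-comm p _)))

    [u*p]²≡p*v²⇒v²≡p*u² : ∀ u v → (u ℕ.* p) ℕ.* (u ℕ.* p) ≡ p ℕ.* (v ℕ.* v) → v ℕ.* v ≡ p ℕ.* (u ℕ.* u)
    [u*p]²≡p*v²⇒v²≡p*u² u v eq = ≡.sym (ℕ.*-cancelˡ-≡ (p ℕ.* (u ℕ.* u)) (v ℕ.* v) p (≡.trans (regroup u p) eq))
      where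
      open ℕ-Solver
      regroup : ∀ u p → p ℕ.* (p ℕ.* (u ℕ.* u)) ≡ (u ℕ.* p) ℕ.* (u ℕ.* p)
      regroup = solve 2 (λ u p → p :* (p :* (u :* u)) := (u :* p) :* (u :* p)) refl

  x*x≡p*y*y⇒y≡0 : ∀ x y → x ℕ.* x ≡ p ℕ.* (y ℕ.* y) → y ≡ 0
  x*x≡p*y*y⇒y≡0 x y = <-rec P descent y x
    where
    P : ℕ → Set
    P y = ∀ x → x ℕ.* x ≡ p ℕ.* (y ℕ.* y) → y ≡ 0

    descent : ∀ y → (∀ {y′} → y′ < y → P y′) → P y
    descent y ih x eq with x*x≡p*y*y⇒p∣x x y eq
    ... | divides x′ refl with [u*p]²≡p*v²⇒v²≡p*u² x′ y eq
    ... | y²≡px′² with x*x≡p*y*y⇒p∣x y x′ y²≡px′²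
    ... | divides zero       refl = refl
    ... | divides y′@(suc _) refl =
      cong (ℕ._* p) (ih (ℕ.m<m*n y′ p (ℕ.nonTrivial⇒n>1 p)) x′ ([u*p]²≡p*v²⇒v²≡p*u² y′ x′ y²≡px′²))

  i*i≡p*j*j⇒j≡0 : ∀ i j → i ℤ.* i ≡ + p ℤ.* (j ℤ.* j) → j ≡ + 0
  i*i≡p*j*j⇒j≡0 i j eq = ℤ.∣i∣≡0⇒i≡0 (x*x≡p*y*y⇒y≡0 ∣ i ∣ ∣ j ∣ (begin
    ∣ i ∣ ℕ.* ∣ i ∣            ≡⟨ ℤ.abs-* i i ⟨
    ∣ i ℤ.* i ∣                ≡⟨ cong ∣_∣ eq ⟩
    ∣ + p ℤ.* (j ℤ.* j) ∣      ≡⟨ ℤ.abs-* (+ p) (j ℤ.* j) ⟩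
    p ℕ.* ∣ j ℤ.* j ∣          ≡⟨ cong (p ℕ.*_) (ℤ.abs-* j j) ⟩
    p ℕ.* (∣ j ∣ ℕ.* ∣ j ∣)    ∎))
    where open ≡-Reasoning

  a*a≡p*b*b⇒b≡0 : ∀ a b → a ℚ.* a ≡ fromℕ p ℚ.* (b ℚ.* b) → b ≡ 0ℚ
  a*a≡p*b*b⇒b≡0 a@(mkℚ _ _ _) b@(mkℚ _ _ _) eq =
    ℚ.↥p≡0⇒p≡0 b ([ id , (λ ()) ]′ (ℤ.i*j≡0⇒i≡0∨j≡0 (↥ b) (i*i≡p*j*j⇒j≡0 (↥ a ℤ.* ↧ b) (↥ b ℤ.* ↧ a) cleared)))
    where
    cross : (↥ a ℤ.* ↥ a) ℤ.* (+ 1 ℤ.* (↧ b ℤ.* ↧ b)) ≡ (+ p ℤ.* (↥ b ℤ.* ↥ b)) ℤ.* (↧ a ℤ.* ↧ a)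
    cross = ℚᵘ.drop-*≡* (ℚᵘ.≃-trans (ℚᵘ.≃-sym (ℚ.toℚᵘ-homo-* a a)) (ℚᵘ.≃-trans (ℚ.toℚᵘ-cong eq)
              (ℚᵘ.≃-trans (ℚ.toℚᵘ-homo-* (fromℕ p) (b ℚ.* b)) (ℚᵘ.*-congˡ {toℚᵘ (fromℕ p)} (ℚ.toℚᵘ-homo-* b b)))))

    cleared : (↥ a ℤ.* ↧ b) ℤ.* (↥ a ℤ.* ↧ b) ≡ + p ℤ.* ((↥ b ℤ.* ↧ a) ℤ.* (↥ b ℤ.* ↧ a))
    cleared = ≡.trans (regroupˡ (↥ a) (↧ b)) (≡.trans cross (regroupʳ (+ p) (↥ b) (↧ a)))
      where
      open ℤ-Solver
      regroupˡ : ∀ x y → (x ℤ.* y) ℤ.* (x ℤ.* y) ≡ (x ℤ.* x) ℤ.* (+ 1 ℤ.* (y ℤ.* y))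
      regroupˡ = solve 2 (λ x y → (x :* y) :* (x :* y) := (x :* x) :* (con (+ 1) :* (y :* y))) refl
      regroupʳ : ∀ q x y → (q ℤ.* (x ℤ.* x)) ℤ.* (y ℤ.* y) ≡ q ℤ.* ((x ℤ.* y) ℤ.* (x ℤ.* y))
      regroupʳ = solve 3 (λ q x y → (q :* (x :* x)) :* (y :* y) := q :* ((x :* y) :* (x :* y))) refl

-- Hamilton quaternions over ℚ(√5)

¬positive-0 : ¬ Positive 0ℚ
¬positive-0 ()

square-nonNeg : ∀ p → NonNegative (p ℚ.* p)
square-nonNeg p@(mkℚ +[1+ _ ] _ _) = ℚ.pos⇒nonNeg (p ℚ.* p) {{ℚ.pos*pos⇒pos p p}}
square-nonNeg p@(mkℚ +0       _ _) = ℚ.nonNeg*nonNeg⇒nonNeg p p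
square-nonNeg p@(mkℚ -[1+ _ ] _ _) = ℚ.pos⇒nonNeg (p ℚ.* p) {{ℚ.neg*neg⇒pos p p}}

square≡0⇒≡0 : ∀ p → p ℚ.* p ≡ 0ℚ → p ≡ 0ℚ
square≡0⇒≡0 p@(mkℚ +[1+ _ ] _ _) eq = contradiction (subst Positive eq (ℚ.pos*pos⇒pos p p)) ¬positive-0
square≡0⇒≡0 p@(mkℚ +0       _ _) eq = ℚ.↥p≡0⇒p≡0 p refl
square≡0⇒≡0 p@(mkℚ -[1+ _ ] _ _) eq = contradiction (subst Positive eq (ℚ.neg*neg⇒pos p p)) ¬positive-0

nonNeg+nonNeg≡0⇒≡0 : ∀ p q .{{_ : NonNegative p}} .{{_ : NonNegative q}} → p ℚ.+ q ≡ 0ℚ → p ≡ 0ℚ × q ≡ 0ℚ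
nonNeg+nonNeg≡0⇒≡0 p q eq with p ℚ.≟ 0ℚ
... | yes refl = refl , ≡.trans (≡.sym (ℚ.+-identityˡ q)) eq
... | no p≢0 = contradiction (subst Positive eq (ℚ.pos+nonNeg⇒pos p q)) ¬positive-0
  where instance
    _ = ℚ.≢-nonZero p≢0
    _ = ℚ.nonNeg∧nonZero⇒pos p

d*p≡0⇒p≡0 : ∀ d p .{{_ : ℚ.NonZero d}} → d ℚ.* p ≡ 0ℚ → p ≡ 0ℚ
d*p≡0⇒p≡0 d p eq = begin
  p                     ≡⟨ ℚ.*-identityˡ p ⟨
  1ℚ ℚ.* p              ≡⟨ cong (ℚ._* p) (ℚ.*-inverseˡ d) ⟨
  (1/ d ℚ.* d) ℚ.* p    ≡⟨ ℚ.*-assoc (1/ d) d p ⟩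
  1/ d ℚ.* (d ℚ.* p)    ≡⟨ cong (1/ d ℚ.*_) eq ⟩
  1/ d ℚ.* 0ℚ           ≡⟨ ℚ.*-zeroʳ (1/ d) ⟩
  0ℚ                    ∎
  where open ≡-Reasoning

module QuadraticExtension (d : ℚ) where

  open ℚ-Solver

  -- (a , b) stands for a + b √d.
  ℚ[√d] : Set
  ℚ[√d] = ℚ × ℚ

  infixl 6 _+_
  infixl 7 _*_
  infix  8 -_

  _+_ : ℚ[√d] → ℚ[√d] → ℚ[√d]
  (a , b) + (c , e) = (a ℚ.+ c , b ℚ.+ e)

  _*_ : ℚ[√d] → ℚ[√d] → ℚ[√d]
  (a , b) * (c , e) = (a ℚ.* c ℚ.+ d ℚ.* (b ℚ.* e) , a ℚ.* e ℚ.+ b ℚ.* c)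

  -_ : ℚ[√d] → ℚ[√d]
  - (a , b) = (ℚ.- a , ℚ.- b)

  0# 1# : ℚ[√d]
  0# = (0ℚ , 0ℚ)
  1# = (1ℚ , 0ℚ)

  isCommutativeRing : IsCommutativeRing _≡_ _+_ _*_ -_ 0# 1#
  isCommutativeRing = record
    { isRing = record
      { +-isAbelianGroup = record
        { isGroup = record
          { isMonoid = record
            { isSemigroup = record
              { isMagma = record { isEquivalence = isEquivalence ; ∙-cong = cong₂ _+_ }
              ; assoc = λ (a , b) (c , e) (f , g) → cong₂ _,_ (ℚ.+-assoc a c f) (ℚ.+-assoc b e g) }
            ; identity = (λ (a , b) → cong₂ _,_ (ℚ.+-identityˡ a) (ℚ.+-identityˡ b))
                       , (λ (a , b) → cong₂ _,_ (ℚ.+-identityʳ a) (ℚ.+-identityʳ b)) }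
          ; inverse = (λ (a , b) → cong₂ _,_ (ℚ.+-inverseˡ a) (ℚ.+-inverseˡ b))
                    , (λ (a , b) → cong₂ _,_ (ℚ.+-inverseʳ a) (ℚ.+-inverseʳ b))
          ; ⁻¹-cong = cong -_ }
        ; comm = λ (a , b) (c , e) → cong₂ _,_ (ℚ.+-comm a c) (ℚ.+-comm b e) }
      ; *-cong = cong₂ _*_
      ; *-assoc = λ (a , b) (c , e) (f , g) → cong₂ _,_
          (solve 7 (λ d a b c e f g → (a :* c :+ d :* (b :* e)) :* f :+ d :* ((a :* e :+ b :* c) :* g)
                                   := a :* (c :* f :+ d :* (e :* g)) :+ d :* (b :* (c :* g :+ e :* f))) refl d a b c e f g)
          (solve 7 (λ d a b c e f g → (a :* c :+ d :* (b :* e)) :* g :+ (a :* e :+ b :* c) :* f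
                                   := a :* (c :* g :+ e :* f) :+ b :* (c :* f :+ d :* (e :* g))) refl d a b c e f g)
      ; *-identity = (λ (a , b) → cong₂ _,_
            (solve 3 (λ d a b → con 1ℚ :* a :+ d :* (con 0ℚ :* b) := a) refl d a b)
            (solve 2 (λ a b → con 1ℚ :* b :+ con 0ℚ :* a := b) refl a b))
          , (λ (a , b) → cong₂ _,_
            (solve 3 (λ d a b → a :* con 1ℚ :+ d :* (b :* con 0ℚ) := a) refl d a b)
            (solve 2 (λ a b → a :* con 0ℚ :+ b :* con 1ℚ := b) refl a b))
      ; distrib = (λ (a , b) (c , e) (f , g) → cong₂ _,_
            (solve 7 (λ d a b c e f g → a :* (c :+ f) :+ d :* (b :* (e :+ g))
                                     := (a :* c :+ d :* (b :* e)) :+ (a :* f :+ d :* (b :* g))) refl d a b c e f g)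
            (solve 6 (λ a b c e f g → a :* (e :+ g) :+ b :* (c :+ f)
                                   := (a :* e :+ b :* c) :+ (a :* g :+ b :* f)) refl a b c e f g))
          , (λ (a , b) (c , e) (f , g) → cong₂ _,_
            (solve 7 (λ d a b c e f g → (c :+ f) :* a :+ d :* ((e :+ g) :* b)
                                     := (c :* a :+ d :* (e :* b)) :+ (f :* a :+ d :* (g :* b))) refl d a b c e f g)
            (solve 6 (λ a b c e f g → (c :+ f) :* b :+ (e :+ g) :* a
                                   := (c :* b :+ e :* a) :+ (f :* b :+ g :* a)) refl a b c e f g)) }
    ; *-comm = λ (a , b) (c , e) → cong₂ _,_
        (solve 5 (λ d a b c e → a :* c :+ d :* (b :* e) := c :* a :+ d :* (e :* b)) refl d a b c e)
        (solve 4 (λ a b c e → a :* e :+ b :* c := c :* b :+ e :* a) refl a b c e) }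

  commutativeRing : CommutativeRing 0ℓ 0ℓ
  commutativeRing = record { isCommutativeRing = isCommutativeRing }
  open CommutativeRing commutativeRing public using (*-assoc)

  _≟_ : (x y : ℚ[√d]) → Dec (x ≡ y)
  _≟_ = ≡-dec ℚ._≟_ ℚ._≟_

  conjugate : ℚ[√d] → ℚ[√d]
  conjugate (a , b) = (a , ℚ.- b)

  norm : ℚ[√d] → ℚ
  norm (a , b) = a ℚ.* a ℚ.- d ℚ.* (b ℚ.* b)

  *-conjugate : ∀ x → x * conjugate x ≡ (norm x , 0ℚ)
  *-conjugate (a , b) = cong₂ _,_
    (solve 3 (λ d a b → a :* a :+ d :* (b :* :- b) := a :* a :- d :* (b :* b)) refl d a b)
    (solve 2 (λ a b → a :* :- b :+ b :* a := con 0ℚ) refl a b)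

  module _ (√d∉ℚ : ∀ a b → a ℚ.* a ≡ d ℚ.* (b ℚ.* b) → b ≡ 0ℚ) where

    norm≢0 : ∀ x → x ≢ 0# → norm x ≢ 0ℚ
    norm≢0 (a , b) x≢0 N≡0 = x≢0 (cong₂ _,_ a≡0 b≡0)
      where
      a²≡db² : a ℚ.* a ≡ d ℚ.* (b ℚ.* b)
      a²≡db² = ℚ+.x∙y⁻¹≈ε⇒x≈y _ _ N≡0
      b≡0 = √d∉ℚ a b a²≡db²
      a≡0 = square≡0⇒≡0 a (≡.trans a²≡db² (≡.trans (cong (λ b → d ℚ.* (b ℚ.* b)) b≡0) (ℚ.*-zeroʳ d)))

    *-inverseʳ : ∀ x → x ≢ 0# → ∃ λ y → x * y ≡ 1#
    *-inverseʳ x x≢0 = conjugate x * (1/ N , 0ℚ) , (begin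
      x * (conjugate x * (1/ N , 0ℚ))  ≡⟨ *-assoc x (conjugate x) _ ⟨
      (x * conjugate x) * (1/ N , 0ℚ)  ≡⟨ cong (_* (1/ N , 0ℚ)) (*-conjugate x) ⟩
      (N , 0ℚ) * (1/ N , 0ℚ)           ≡⟨ cong₂ _,_ (≡.trans (solve 3 (λ d n i → n :* i :+ d :* (con 0ℚ :* con 0ℚ) := n :* i) refl d N (1/ N)) (ℚ.*-inverseʳ N))
                                                     (solve 2 (λ n i → n :* con 0ℚ :+ con 0ℚ :* i := con 0ℚ) refl N (1/ N)) ⟩
      1#                               ∎)
      where
      N = norm x
      instance _ = ℚ.≢-nonZero (norm≢0 x x≢0)
      open ≡-Reasoning

  module _ .{{_ : Positive d}} where

    proj₁[x*x]-nonNeg : ∀ x → NonNegative (proj₁ (x * x))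
    proj₁[x*x]-nonNeg (a , b) = ℚ.nonNeg+nonNeg⇒nonNeg (a ℚ.* a) {{square-nonNeg a}} (d ℚ.* (b ℚ.* b))
      {{ℚ.nonNeg*nonNeg⇒nonNeg d {{ℚ.pos⇒nonNeg d}} (b ℚ.* b) {{square-nonNeg b}}}}

    proj₁[x*x]≡0⇒x≡0 : ∀ x → proj₁ (x * x) ≡ 0ℚ → x ≡ 0#
    proj₁[x*x]≡0⇒x≡0 (a , b) eq with a²≡0 , db²≡0 ← nonNeg+nonNeg≡0⇒≡0 (a ℚ.* a) (d ℚ.* (b ℚ.* b))
        {{square-nonNeg a}} {{ℚ.nonNeg*nonNeg⇒nonNeg d {{ℚ.pos⇒nonNeg d}} (b ℚ.* b) {{square-nonNeg b}}}} eq =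
      cong₂ _,_ (square≡0⇒≡0 a a²≡0) (square≡0⇒≡0 b (d*p≡0⇒p≡0 d (b ℚ.* b) {{ℚ.pos⇒nonZero d}} db²≡0))

module Quaternion where

  record ℍ (A : Set) : Set where
    constructor ⟨_,_,_,_⟩
    field q₀ q₁ q₂ q₃ : A
  open ℍ

  ℍ-ext : ∀ {A} {x y : ℍ A} → q₀ x ≡ q₀ y → q₁ x ≡ q₁ y → q₂ x ≡ q₂ y → q₃ x ≡ q₃ y → x ≡ y
  ℍ-ext refl refl refl refl = refl

  -- Generic in the coefficients so that the same formulas, read in the ring solver's syntax of
  -- polynomials, state each ring law one coordinate at a time.
  module QuaternionOperations {A : Set} (add mul : A → A → A) (neg : A → A) (zero one : A) where
    private
      infixl 6 _⊕_ _⊖_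
      infixl 7 _⊗_
      _⊕_ = add
      _⊗_ = mul
      _⊖_ : A → A → A
      x ⊖ y = x ⊕ neg y

    infixl 6 _+_
    infixl 7 _*_ _⋆_
    infix  8 -_

    _+_ : ℍ A → ℍ A → ℍ A
    ⟨ a₁ , b₁ , c₁ , d₁ ⟩ + ⟨ a₂ , b₂ , c₂ , d₂ ⟩ = ⟨ a₁ ⊕ a₂ , b₁ ⊕ b₂ , c₁ ⊕ c₂ , d₁ ⊕ d₂ ⟩

    -_ : ℍ A → ℍ A
    - ⟨ a , b , c , d ⟩ = ⟨ neg a , neg b , neg c , neg d ⟩

    _*_ : ℍ A → ℍ A → ℍ A
    ⟨ a₁ , b₁ , c₁ , d₁ ⟩ * ⟨ a₂ , b₂ , c₂ , d₂ ⟩ =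
      ⟨ a₁ ⊗ a₂ ⊖ b₁ ⊗ b₂ ⊖ c₁ ⊗ c₂ ⊖ d₁ ⊗ d₂
      , a₁ ⊗ b₂ ⊕ b₁ ⊗ a₂ ⊕ c₁ ⊗ d₂ ⊖ d₁ ⊗ c₂
      , a₁ ⊗ c₂ ⊖ b₁ ⊗ d₂ ⊕ c₁ ⊗ a₂ ⊕ d₁ ⊗ b₂
      , a₁ ⊗ d₂ ⊕ b₁ ⊗ c₂ ⊖ c₁ ⊗ b₂ ⊕ d₁ ⊗ a₂ ⟩

    0ℍ 1ℍ : ℍ A
    0ℍ = ⟨ zero , zero , zero , zero ⟩
    1ℍ = ⟨ one , zero , zero , zero ⟩

    scalar : A → ℍ A
    scalar s = ⟨ s , zero , zero , zero ⟩

    _⋆_ : A → ℍ A → ℍ A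
    s ⋆ ⟨ a , b , c , d ⟩ = ⟨ s ⊗ a , s ⊗ b , s ⊗ c , s ⊗ d ⟩

    conjugate : ℍ A → ℍ A
    conjugate ⟨ a , b , c , d ⟩ = ⟨ a , neg b , neg c , neg d ⟩

    norm : ℍ A → A
    norm ⟨ a , b , c , d ⟩ = a ⊗ a ⊕ b ⊗ b ⊕ c ⊗ c ⊕ d ⊗ d

  module K = QuadraticExtension (fromℕ 5)

  ℚ[√5] : Set
  ℚ[√5] = K.ℚ[√d]

  open QuaternionOperations K._+_ K._*_ K.-_ K.0# K.1# public
  open RingSolver (fromCommutativeRing K.commutativeRing) K._≟_ using (solve; _:=_; _:+_; _:*_; :-_; con; Polynomial)

  private
    module P {n} = QuaternionOperations {Polynomial n} _:+_ _:*_ :-_ (con K.0#) (con K.1#)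

    Law : (n : ℕ) → Set _
    Law n = N-ary n (Polynomial n) (Polynomial n × Polynomial n)

    Coordinate = ∀ {A} → ℍ A → A

    *-assoc-law : Coordinate → Law 12
    *-assoc-law π a₁ b₁ c₁ d₁ a₂ b₂ c₂ d₂ a₃ b₃ c₃ d₃ = π ((x P.* y) P.* z) := π (x P.* (y P.* z))
      where x = ⟨ a₁ , b₁ , c₁ , d₁ ⟩; y = ⟨ a₂ , b₂ , c₂ , d₂ ⟩; z = ⟨ a₃ , b₃ , c₃ , d₃ ⟩

    *-distribˡ-law : Coordinate → Law 12
    *-distribˡ-law π a₁ b₁ c₁ d₁ a₂ b₂ c₂ d₂ a₃ b₃ c₃ d₃ = π (x P.* (y P.+ z)) := π (x P.* y P.+ x P.* z)
      where x = ⟨ a₁ , b₁ , c₁ , d₁ ⟩; y = ⟨ a₂ , b₂ , c₂ , d₂ ⟩; z = ⟨ a₃ , b₃ , c₃ , d₃ ⟩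

    *-distribʳ-law : Coordinate → Law 12
    *-distribʳ-law π a₁ b₁ c₁ d₁ a₂ b₂ c₂ d₂ a₃ b₃ c₃ d₃ = π ((y P.+ z) P.* x) := π (y P.* x P.+ z P.* x)
      where x = ⟨ a₁ , b₁ , c₁ , d₁ ⟩; y = ⟨ a₂ , b₂ , c₂ , d₂ ⟩; z = ⟨ a₃ , b₃ , c₃ , d₃ ⟩

    *-identityˡ-law : Coordinate → Law 4
    *-identityˡ-law π a b c d = π (P.1ℍ P.* ⟨ a , b , c , d ⟩) := π ⟨ a , b , c , d ⟩

    *-identityʳ-law : Coordinate → Law 4
    *-identityʳ-law π a b c d = π (⟨ a , b , c , d ⟩ P.* P.1ℍ) := π ⟨ a , b , c , d ⟩

    *-conjugateʳ-law : Coordinate → Law 5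
    *-conjugateʳ-law π s a b c d = π (x P.* (s P.⋆ P.conjugate x)) := π (P.scalar (P.norm x :* s))
      where x = ⟨ a , b , c , d ⟩

    *-conjugateˡ-law : Coordinate → Law 5
    *-conjugateˡ-law π s a b c d = π ((s P.⋆ P.conjugate x) P.* x) := π (P.scalar (P.norm x :* s))
      where x = ⟨ a , b , c , d ⟩

  *-assoc : ∀ (x y z : ℍ ℚ[√5]) → (x * y) * z ≡ x * (y * z)
  *-assoc ⟨ a₁ , b₁ , c₁ , d₁ ⟩ ⟨ a₂ , b₂ , c₂ , d₂ ⟩ ⟨ a₃ , b₃ , c₃ , d₃ ⟩ = ℍ-ext
    (solve 12 (*-assoc-law q₀) refl a₁ b₁ c₁ d₁ a₂ b₂ c₂ d₂ a₃ b₃ c₃ d₃)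
    (solve 12 (*-assoc-law q₁) refl a₁ b₁ c₁ d₁ a₂ b₂ c₂ d₂ a₃ b₃ c₃ d₃)
    (solve 12 (*-assoc-law q₂) refl a₁ b₁ c₁ d₁ a₂ b₂ c₂ d₂ a₃ b₃ c₃ d₃)
    (solve 12 (*-assoc-law q₃) refl a₁ b₁ c₁ d₁ a₂ b₂ c₂ d₂ a₃ b₃ c₃ d₃)

  *-distribˡ-+ : ∀ (x y z : ℍ ℚ[√5]) → x * (y + z) ≡ x * y + x * z
  *-distribˡ-+ ⟨ a₁ , b₁ , c₁ , d₁ ⟩ ⟨ a₂ , b₂ , c₂ , d₂ ⟩ ⟨ a₃ , b₃ , c₃ , d₃ ⟩ = ℍ-ext
    (solve 12 (*-distribˡ-law q₀) refl a₁ b₁ c₁ d₁ a₂ b₂ c₂ d₂ a₃ b₃ c₃ d₃)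
    (solve 12 (*-distribˡ-law q₁) refl a₁ b₁ c₁ d₁ a₂ b₂ c₂ d₂ a₃ b₃ c₃ d₃)
    (solve 12 (*-distribˡ-law q₂) refl a₁ b₁ c₁ d₁ a₂ b₂ c₂ d₂ a₃ b₃ c₃ d₃)
    (solve 12 (*-distribˡ-law q₃) refl a₁ b₁ c₁ d₁ a₂ b₂ c₂ d₂ a₃ b₃ c₃ d₃)

  *-distribʳ-+ : ∀ (x y z : ℍ ℚ[√5]) → (y + z) * x ≡ y * x + z * x
  *-distribʳ-+ ⟨ a₁ , b₁ , c₁ , d₁ ⟩ ⟨ a₂ , b₂ , c₂ , d₂ ⟩ ⟨ a₃ , b₃ , c₃ , d₃ ⟩ = ℍ-ext
    (solve 12 (*-distribʳ-law q₀) refl a₁ b₁ c₁ d₁ a₂ b₂ c₂ d₂ a₃ b₃ c₃ d₃)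
    (solve 12 (*-distribʳ-law q₁) refl a₁ b₁ c₁ d₁ a₂ b₂ c₂ d₂ a₃ b₃ c₃ d₃)
    (solve 12 (*-distribʳ-law q₂) refl a₁ b₁ c₁ d₁ a₂ b₂ c₂ d₂ a₃ b₃ c₃ d₃)
    (solve 12 (*-distribʳ-law q₃) refl a₁ b₁ c₁ d₁ a₂ b₂ c₂ d₂ a₃ b₃ c₃ d₃)

  *-identityˡ : ∀ (x : ℍ ℚ[√5]) → 1ℍ * x ≡ x
  *-identityˡ ⟨ a , b , c , d ⟩ = ℍ-ext
    (solve 4 (*-identityˡ-law q₀) refl a b c d) (solve 4 (*-identityˡ-law q₁) refl a b c d)
    (solve 4 (*-identityˡ-law q₂) refl a b c d) (solve 4 (*-identityˡ-law q₃) refl a b c d)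

  *-identityʳ : ∀ (x : ℍ ℚ[√5]) → x * 1ℍ ≡ x
  *-identityʳ ⟨ a , b , c , d ⟩ = ℍ-ext
    (solve 4 (*-identityʳ-law q₀) refl a b c d) (solve 4 (*-identityʳ-law q₁) refl a b c d)
    (solve 4 (*-identityʳ-law q₂) refl a b c d) (solve 4 (*-identityʳ-law q₃) refl a b c d)

  *-conjugateʳ : ∀ s (x : ℍ ℚ[√5]) → x * (s ⋆ conjugate x) ≡ scalar (norm x K.* s)
  *-conjugateʳ s ⟨ a , b , c , d ⟩ = ℍ-ext
    (solve 5 (*-conjugateʳ-law q₀) refl s a b c d) (solve 5 (*-conjugateʳ-law q₁) refl s a b c d)
    (solve 5 (*-conjugateʳ-law q₂) refl s a b c d) (solve 5 (*-conjugateʳ-law q₃) refl s a b c d)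

  *-conjugateˡ : ∀ s (x : ℍ ℚ[√5]) → (s ⋆ conjugate x) * x ≡ scalar (norm x K.* s)
  *-conjugateˡ s ⟨ a , b , c , d ⟩ = ℍ-ext
    (solve 5 (*-conjugateˡ-law q₀) refl s a b c d) (solve 5 (*-conjugateˡ-law q₁) refl s a b c d)
    (solve 5 (*-conjugateˡ-law q₂) refl s a b c d) (solve 5 (*-conjugateˡ-law q₃) refl s a b c d)

  infix 4 _≟_
  _≟_ : (x y : ℍ ℚ[√5]) → Dec (x ≡ y)
  x ≟ y = map′ (λ (e₀ , e₁ , e₂ , e₃) → ℍ-ext e₀ e₁ e₂ e₃) (λ { refl → refl , refl , refl , refl })
    (q₀ x K.≟ q₀ y ×-dec q₁ x K.≟ q₁ y ×-dec q₂ x K.≟ q₂ y ×-dec q₃ x K.≟ q₃ y)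

  private module Kᴿ = CommutativeRing K.commutativeRing

  isRing : IsRing _≡_ _+_ _*_ -_ 0ℍ 1ℍ
  isRing = record
    { +-isAbelianGroup = record
      { isGroup = record
        { isMonoid = record
          { isSemigroup = record
            { isMagma = record { isEquivalence = isEquivalence ; ∙-cong = cong₂ _+_ }
            ; assoc = λ (⟨ a₁ , b₁ , c₁ , d₁ ⟩) (⟨ a₂ , b₂ , c₂ , d₂ ⟩) (⟨ a₃ , b₃ , c₃ , d₃ ⟩) → ℍ-ext
                (Kᴿ.+-assoc a₁ a₂ a₃) (Kᴿ.+-assoc b₁ b₂ b₃) (Kᴿ.+-assoc c₁ c₂ c₃) (Kᴿ.+-assoc d₁ d₂ d₃) }
          ; identity = (λ (⟨ a , b , c , d ⟩) → ℍ-ext (Kᴿ.+-identityˡ a) (Kᴿ.+-identityˡ b) (Kᴿ.+-identityˡ c) (Kᴿ.+-identityˡ d))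
                     , (λ (⟨ a , b , c , d ⟩) → ℍ-ext (Kᴿ.+-identityʳ a) (Kᴿ.+-identityʳ b) (Kᴿ.+-identityʳ c) (Kᴿ.+-identityʳ d)) }
        ; inverse = (λ (⟨ a , b , c , d ⟩) → ℍ-ext (Kᴿ.-‿inverseˡ a) (Kᴿ.-‿inverseˡ b) (Kᴿ.-‿inverseˡ c) (Kᴿ.-‿inverseˡ d))
                  , (λ (⟨ a , b , c , d ⟩) → ℍ-ext (Kᴿ.-‿inverseʳ a) (Kᴿ.-‿inverseʳ b) (Kᴿ.-‿inverseʳ c) (Kᴿ.-‿inverseʳ d))
        ; ⁻¹-cong = cong -_ }
      ; comm = λ (⟨ a₁ , b₁ , c₁ , d₁ ⟩) (⟨ a₂ , b₂ , c₂ , d₂ ⟩) → ℍ-ext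
          (Kᴿ.+-comm a₁ a₂) (Kᴿ.+-comm b₁ b₂) (Kᴿ.+-comm c₁ c₂) (Kᴿ.+-comm d₁ d₂) }
    ; *-cong = cong₂ _*_
    ; *-assoc = *-assoc
    ; *-identity = *-identityˡ , *-identityʳ
    ; distrib = *-distribˡ-+ , *-distribʳ-+ }

  -- ℚ(√5) is real: the rational part of a sum of squares is a positive definite form over ℚ.
  norm≡0⇒≡0 : ∀ x → norm x ≡ K.0# → x ≡ 0ℍ
  norm≡0⇒≡0 ⟨ a , b , c , d ⟩ N≡0 = ℍ-ext
    (K.proj₁[x*x]≡0⇒x≡0 a (proj₁ ab≡0)) (K.proj₁[x*x]≡0⇒x≡0 b (proj₂ ab≡0))
    (K.proj₁[x*x]≡0⇒x≡0 c (proj₂ abc≡0)) (K.proj₁[x*x]≡0⇒x≡0 d (proj₂ abcd≡0))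
    where
    Q = λ x → proj₁ (x K.* x)
    instance
      _ = K.proj₁[x*x]-nonNeg a
      _ = K.proj₁[x*x]-nonNeg b
      _ = K.proj₁[x*x]-nonNeg c
      _ = K.proj₁[x*x]-nonNeg d
    nonNeg₂ : NonNegative (Q a ℚ.+ Q b)
    nonNeg₂ = ℚ.nonNeg+nonNeg⇒nonNeg (Q a) (Q b)
    nonNeg₃ : NonNegative (Q a ℚ.+ Q b ℚ.+ Q c)
    nonNeg₃ = ℚ.nonNeg+nonNeg⇒nonNeg (Q a ℚ.+ Q b) {{nonNeg₂}} (Q c)
    abcd≡0 = nonNeg+nonNeg≡0⇒≡0 (Q a ℚ.+ Q b ℚ.+ Q c) (Q d) {{nonNeg₃}} (cong proj₁ N≡0)
    abc≡0 = nonNeg+nonNeg≡0⇒≡0 (Q a ℚ.+ Q b) (Q c) {{nonNeg₂}} (proj₁ abcd≡0)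
    ab≡0 = nonNeg+nonNeg≡0⇒≡0 (Q a) (Q b) (proj₁ abc≡0)

  private
    5-prime : Prime 5
    5-prime = from-yes (prime? 5)

  0≢1 : 0ℍ ≢ 1ℍ
  0≢1 eq = ℚ.1≢0 (≡.sym (cong (proj₁ ∘′ q₀) eq))

  divisionRing : DivisionRing 0ℓ 0ℓ
  divisionRing = record
    { ring = record { isRing = isRing }
    ; 0≉1 = 0≢1
    ; inverse = inverse }
    where
    inverse : ∀ x → x ≢ 0ℍ → ∃ λ y → x * y ≡ 1ℍ × y * x ≡ 1ℍ
    inverse x x≢0 = s ⋆ conjugate x , ≡.trans (*-conjugateʳ s x) (cong scalar Ns≡1) , ≡.trans (*-conjugateˡ s x) (cong scalar Ns≡1)
      where
      norm⁻¹ = K.*-inverseʳ (a*a≡p*b*b⇒b≡0 5-prime) (norm x) (x≢0 ∘′ norm≡0⇒≡0 x)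
      s = proj₁ norm⁻¹
      Ns≡1 = proj₂ norm⁻¹

  infixr 8 _^_
  _^_ : ℍ ℚ[√5] → ℕ → ℍ ℚ[√5]
  x ^ zero  = 1ℍ
  x ^ suc n = x * x ^ n

  𝐤 : ℍ ℚ[√5]
  𝐤 = ⟨ K.0# , K.0# , K.0# , K.1# ⟩

-- Division rings and the groups they contain

module DivisionRingProperties {c ℓ : Level} (D : DivisionRing c ℓ) where
  open DivisionRing D using (0≉1; inverse)
  open Ring (DivisionRing.ring D)
  open import Algebra.Properties.Ring (DivisionRing.ring D)
  import Algebra.Properties.AbelianGroup +-abelianGroup as +-AbelianGroup
  import Algebra.Properties.Group +-group as +-Group
  import Algebra.Properties.CommutativeSemigroup +-commutativeSemigroup as +-CommutativeSemigroup
  open import Relation.Binary.Reasoning.Setoid setoid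

  x*y≈0⇒y≈0 : ∀ {x y} → ¬ x ≈ 0# → x * y ≈ 0# → y ≈ 0#
  x*y≈0⇒y≈0 {x} {y} x≉0 xy≈0 with x⁻¹ , _ , x⁻¹x≈1 ← inverse x x≉0 = begin
    y              ≈⟨ *-identityˡ y ⟨
    1# * y         ≈⟨ *-congʳ x⁻¹x≈1 ⟨
    (x⁻¹ * x) * y  ≈⟨ *-assoc x⁻¹ x y ⟩
    x⁻¹ * (x * y)  ≈⟨ *-congˡ xy≈0 ⟩
    x⁻¹ * 0#       ≈⟨ zeroʳ x⁻¹ ⟩
    0#             ∎

  x*y≈0⇒x≈0 : ∀ {x y} → ¬ y ≈ 0# → x * y ≈ 0# → x ≈ 0#
  x*y≈0⇒x≈0 {x} {y} y≉0 xy≈0 with y⁻¹ , yy⁻¹≈1 , _ ← inverse y y≉0 = begin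
    x              ≈⟨ *-identityʳ x ⟨
    x * 1#         ≈⟨ *-congˡ yy⁻¹≈1 ⟨
    x * (y * y⁻¹)  ≈⟨ *-assoc x y y⁻¹ ⟨
    (x * y) * y⁻¹  ≈⟨ *-congʳ xy≈0 ⟩
    0# * y⁻¹       ≈⟨ zeroˡ y⁻¹ ⟩
    0#             ∎

  *-cancelˡ : ∀ {x y z} → ¬ x ≈ 0# → x * y ≈ x * z → y ≈ z
  *-cancelˡ {x} {y} {z} x≉0 eq = +-Group.x∙y⁻¹≈ε⇒x≈y y z
    (x*y≈0⇒y≈0 x≉0 (trans (x[y-z]≈xy-xz x y z) (+-Group.x≈y⇒x∙y⁻¹≈ε eq)))

  *-cancelʳ : ∀ {x y z} → ¬ x ≈ 0# → y * x ≈ z * x → y ≈ z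
  *-cancelʳ {x} {y} {z} x≉0 eq = +-Group.x∙y⁻¹≈ε⇒x≈y y z
    (x*y≈0⇒x≈0 x≉0 (trans ([y-z]x≈yx-zx x y z) (+-Group.x≈y⇒x∙y⁻¹≈ε eq)))

  x*x≈-1⇒x≉0 : ∀ {x} → x * x ≈ - 1# → ¬ x ≈ 0#
  x*x≈-1⇒x≉0 {x} xx≈-1 x≈0 = 0≉1 (begin
    0#          ≈⟨ +-Group.ε⁻¹≈ε ⟨
    - 0#        ≈⟨ -‿cong (zeroˡ x) ⟨
    - (0# * x)  ≈⟨ -‿cong (*-congʳ x≈0) ⟨
    - (x * x)   ≈⟨ -‿cong xx≈-1 ⟩
    - - 1#      ≈⟨ +-Group.⁻¹-involutive 1# ⟩
    1#          ∎)

  square-roots : ∀ {x y} → x * y ≈ y * x → x * x ≈ y * y → ¬ x ≈ y → x ≈ - y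
  square-roots {x} {y} xy≈yx xx≈yy x≉y =
    +-Group.inverseˡ-unique x y (x*y≈0⇒y≈0 (x≉y ∘′ +-Group.x∙y⁻¹≈ε⇒x≈y x y) (begin
      (x - y) * (x + y)              ≈⟨ distribˡ (x - y) x y ⟩
      (x - y) * x + (x - y) * y      ≈⟨ +-cong ([y-z]x≈yx-zx x x y) ([y-z]x≈yx-zx y x y) ⟩
      (x * x - y * x) + (x * y - y * y) ≈⟨ +-cong (+-congʳ xx≈yy) (+-congʳ xy≈yx) ⟩
      (y * y - y * x) + (y * x - y * y) ≈⟨ +-congˡ (+-AbelianGroup.⁻¹-anti-homo‿- (y * y) (y * x)) ⟨
      (y * y - y * x) + - (y * y - y * x) ≈⟨ -‿inverseʳ (y * y - y * x) ⟩
      0#                             ∎))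

  x*x≈1⇒x≈-1 : ∀ {x} → x * x ≈ 1# → ¬ x ≈ 1# → x ≈ - 1#
  x*x≈1⇒x≈-1 {x} xx≈1 = square-roots (trans (*-identityʳ x) (sym (*-identityˡ x))) (trans xx≈1 (sym (*-identityˡ 1#)))

  *-fixed⇒≈0 : ∀ {x p} → ¬ x ≈ 1# → x * p ≈ p → p ≈ 0#
  *-fixed⇒≈0 {x} {p} x≉1 xp≈p = x*y≈0⇒y≈0 (x≉1 ∘′ +-Group.x∙y⁻¹≈ε⇒x≈y x 1#) (begin
    (x - 1#) * p    ≈⟨ [y-z]x≈yx-zx p x 1# ⟩
    x * p - 1# * p  ≈⟨ +-cong xp≈p (-‿cong (*-identityˡ p)) ⟩
    p - p           ≈⟨ -‿inverseʳ p ⟩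
    0#              ∎)

  x³≈1⇒x²+x+1≈0 : ∀ {x} → x * (x * x) ≈ 1# → ¬ x ≈ 1# → x * x + x + 1# ≈ 0#
  x³≈1⇒x²+x+1≈0 {x} x³≈1 x≉1 = *-fixed⇒≈0 x≉1 (begin
    x * (x * x + x + 1#)          ≈⟨ distribˡ x (x * x + x) 1# ⟩
    x * (x * x + x) + x * 1#      ≈⟨ +-cong (distribˡ x (x * x) x) (*-identityʳ x) ⟩
    (x * (x * x) + x * x) + x     ≈⟨ +-congʳ (+-congʳ x³≈1) ⟩
    (1# + x * x) + x              ≈⟨ +-assoc 1# (x * x) x ⟩
    1# + (x * x + x)              ≈⟨ +-comm 1# (x * x + x) ⟩
    x * x + x + 1#                ∎)

  ¬C₃⋊C₈ : ∀ {b c w} → b * b ≈ c → c * c ≈ - 1# → w * (w * w) ≈ 1# → ¬ w ≈ 1# →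
           c * w ≈ w * c → b * w ≈ (w * w) * b → ⊥
  ¬C₃⋊C₈ {b} {c} {w} b²≈c c²≈-1 w³≈1 w≉1 cw≈wc bw≈w²b =
    commutes-with-b⇒≉y (-1b≈b-1) (x*x≈1⇒x≈-1 y²≈1 (commutes-with-b⇒≉y 1b≈b1))
    where
    e = w + c
    e′ = w * w + c
    y = e * b

    be≈e′b : b * e ≈ e′ * b
    be≈e′b = begin
      b * (w + c)             ≈⟨ distribˡ b w c ⟩
      b * w + b * c           ≈⟨ +-cong bw≈w²b (begin
        b * c                   ≈⟨ *-congˡ b²≈c ⟨
        b * (b * b)             ≈⟨ *-assoc b b b ⟨
        (b * b) * b             ≈⟨ *-congʳ b²≈c ⟩
        c * b                   ∎) ⟩
      (w * w) * b + c * b     ≈⟨ distribʳ b (w * w) c ⟨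
      (w * w + c) * b         ∎

    ee′≈-c : e * e′ ≈ - c
    ee′≈-c = begin
      (w + c) * (w * w + c)                           ≈⟨ distribˡ (w + c) (w * w) c ⟩
      (w + c) * (w * w) + (w + c) * c                 ≈⟨ +-cong (distribʳ (w * w) w c) (distribʳ c w c) ⟩
      (w * (w * w) + c * (w * w)) + (w * c + c * c)   ≈⟨ +-cong (+-congʳ w³≈1) (trans (+-comm _ _) (+-cong c²≈-1 (sym cw≈wc))) ⟩
      (1# + c * (w * w)) + (- 1# + c * w)             ≈⟨ +-CommutativeSemigroup.interchange 1# _ (- 1#) _ ⟩
      (1# - 1#) + (c * (w * w) + c * w)               ≈⟨ +-cong (-‿inverseʳ 1#) (sym (distribˡ c (w * w) w)) ⟩
      0# + c * (w * w + w)                            ≈⟨ +-identityˡ _ ⟩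
      c * (w * w + w)                                 ≈⟨ *-congˡ (+-Group.inverseˡ-unique _ _ (x³≈1⇒x²+x+1≈0 w³≈1 w≉1)) ⟩
      c * - 1#                                        ≈⟨ -‿distribʳ-* c 1# ⟨
      - (c * 1#)                                      ≈⟨ -‿cong (*-identityʳ c) ⟩
      - c                                             ∎

    y²≈1 : y * y ≈ 1#
    y²≈1 = begin
      (e * b) * (e * b)    ≈⟨ *-assoc e b (e * b) ⟩
      e * (b * (e * b))    ≈⟨ *-congˡ (*-assoc b e b) ⟨
      e * ((b * e) * b)    ≈⟨ *-congˡ (*-congʳ be≈e′b) ⟩
      e * ((e′ * b) * b)   ≈⟨ *-congˡ (*-assoc e′ b b) ⟩
      e * (e′ * (b * b))   ≈⟨ *-assoc e e′ (b * b) ⟨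
      (e * e′) * (b * b)   ≈⟨ *-cong ee′≈-c b²≈c ⟩
      - c * c              ≈⟨ -‿distribˡ-* c c ⟨
      - (c * c)            ≈⟨ -‿cong c²≈-1 ⟩
      - - 1#               ≈⟨ +-Group.⁻¹-involutive 1# ⟩
      1#                   ∎

    yb≉by : ¬ y * b ≈ b * y
    yb≉by yb≈by = w≉1 (sym (*-cancelˡ w≉0 (trans (*-identityʳ w) w≈w²)))
      where
      w≉0 : ¬ w ≈ 0#
      w≉0 w≈0 = 0≉1 (trans (sym (trans (*-congʳ w≈0) (zeroˡ (w * w)))) w³≈1)
      ec≈e′c : e * c ≈ e′ * c
      ec≈e′c = begin
        e * c          ≈⟨ *-congˡ b²≈c ⟨
        e * (b * b)    ≈⟨ *-assoc e b b ⟨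
        y * b          ≈⟨ yb≈by ⟩
        b * (e * b)    ≈⟨ *-assoc b e b ⟨
        (b * e) * b    ≈⟨ *-congʳ be≈e′b ⟩
        (e′ * b) * b   ≈⟨ *-assoc e′ b b ⟩
        e′ * (b * b)   ≈⟨ *-congˡ b²≈c ⟩
        e′ * c         ∎
      w≈w² : w ≈ w * w
      w≈w² = +-Group.∙-cancelʳ c w (w * w) (*-cancelʳ (x*x≈-1⇒x≉0 c²≈-1) ec≈e′c)

    commutes-with-b⇒≉y : ∀ {u} → u * b ≈ b * u → ¬ y ≈ u
    commutes-with-b⇒≉y {u} ub≈bu y≈u = yb≉by (begin
      y * b   ≈⟨ *-congʳ y≈u ⟩
      u * b   ≈⟨ ub≈bu ⟩
      b * u   ≈⟨ *-congˡ y≈u ⟨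
      b * y   ∎)

    1b≈b1 : 1# * b ≈ b * 1#
    1b≈b1 = trans (*-identityˡ b) (sym (*-identityʳ b))

    -1b≈b-1 : - 1# * b ≈ b * - 1#
    -1b≈b-1 = begin
      - 1# * b     ≈⟨ -‿distribˡ-* 1# b ⟨
      - (1# * b)   ≈⟨ -‿cong 1b≈b1 ⟩
      - (b * 1#)   ≈⟨ -‿distribʳ-* b 1# ⟩
      b * - 1#     ∎

module EmbeddingProperties {M : RawMonoid 0ℓ 0ℓ} (D : DivisionRing 0ℓ 0ℓ) (embedding : EmbeddingInto M D) where
  private
    module M = RawMonoid M
    open DivisionRing D using (ring)
    open Ring ring
    open DivisionRingProperties D

  f = proj₁ embedding

  image-∙ : ∀ {x y z} → x M.∙ y ≡ z → f x * f y ≈ f z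
  image-∙ {x} {y} ≡.refl = sym (proj₁ (proj₂ (proj₂ embedding)) x y)

  image-ε : f M.ε ≈ 1#
  image-ε = proj₂ (proj₂ (proj₂ embedding))

  image≉1 : ∀ {x} → ¬ x M.≈ M.ε → ¬ f x ≈ 1#
  image≉1 x≉ε fx≈1 = x≉ε (proj₁ (proj₂ embedding) (trans fx≈1 (sym image-ε)))

  image-involution : ∀ {x} → x M.∙ x ≡ M.ε → ¬ x M.≈ M.ε → f x ≈ - 1#
  image-involution xx≡ε x≉ε = x*x≈1⇒x≈-1 (trans (image-∙ xx≡ε) image-ε) (image≉1 x≉ε)

embeds-along-≅ : ∀ {A B : RawMonoid 0ℓ 0ℓ} → (∀ {x y} → RawMonoid._≈_ B x y → x ≡ y) →
                 A ≅ B → EmbedsInDivisionRing B → EmbedsInDivisionRing A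
embeds-along-≅ B-≈⇒≡ (φ , (φ-injective , _) , φ-∙ , φ-ε) (D , f , f-injective , f-∙ , f-ε) =
  D , f ∘′ φ , φ-injective ∘′ f-injective ,
  (λ x y → trans (reflexive (cong f (B-≈⇒≡ (φ-∙ x y)))) (f-∙ (φ x) (φ y))) ,
  trans (reflexive (cong f (B-≈⇒≡ φ-ε))) f-ε
  where open Ring (DivisionRing.ring D)

two-involutions⇒¬embeds : ∀ {M : RawMonoid 0ℓ 0ℓ} (let module M = RawMonoid M) {x y} →
  x M.∙ x ≡ M.ε → y M.∙ y ≡ M.ε → ¬ x M.≈ M.ε → ¬ y M.≈ M.ε → ¬ x M.≈ y → ¬ EmbedsInDivisionRing M
two-involutions⇒¬embeds xx≡ε yy≡ε x≉ε y≉ε x≉y (D , embedding) =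
  x≉y (proj₁ (proj₂ embedding) (trans (image-involution xx≡ε x≉ε) (sym (image-involution yy≡ε y≉ε))))
  where
  open Ring (DivisionRing.ring D)
  open EmbeddingProperties D embedding

module FiniteEmbedding (M : RawMonoid 0ℓ 0ℓ) (D : DivisionRing 0ℓ 0ℓ)
         (all? : ∀ {P : RawMonoid.Carrier M → Set} → (∀ x → Dec (P x)) → Dec (∀ x → P x))
         (_≟ᴹ_ : Decidable (RawMonoid._≈_ M)) (_≟ᴰ_ : Decidable (DivisionRing._≈_ D)) where

  private
    module M = RawMonoid M
    module D = DivisionRing D

  IsEmbedding : (M.Carrier → D.Carrier) → Set
  IsEmbedding f = (∀ x y → f x D.≈ f y → x M.≈ y) × (∀ x y → f (x M.∙ y) D.≈ f x D.· f y) × f M.ε D.≈ D.1#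

  isEmbedding? : ∀ f → Dec (IsEmbedding f)
  isEmbedding? f = (all? λ x → all? λ y → (f x ≟ᴰ f y) →-dec (x ≟ᴹ y))
             ×-dec (all? λ x → all? λ y → f (x M.∙ y) ≟ᴰ (f x D.· f y))
             ×-dec (f M.ε ≟ᴰ D.1#)

  embedding : ∀ f → IsEmbedding f → EmbeddingInto M D
  embedding f (injective , homomorphic , unit) = f , (λ {x} {y} → injective x y) , homomorphic , unit

-- The groups G_{m,r}

module _ {m : ℕ} .{{_ : NonZero m}} where
  open import Data.Nat using (_+_; _*_)

  +-cong-% : ∀ {a a′ b b′} → a % m ≡ a′ % m → b % m ≡ b′ % m → (a + b) % m ≡ (a′ + b′) % m
  +-cong-% {a} {a′} {b} {b′} a≡a′ b≡b′ = begin
    (a + b) % m              ≡⟨ %-distribˡ-+ a b m ⟩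
    (a % m + b % m) % m      ≡⟨ cong₂ (λ x y → (x + y) % m) a≡a′ b≡b′ ⟩
    (a′ % m + b′ % m) % m    ≡⟨ %-distribˡ-+ a′ b′ m ⟨
    (a′ + b′) % m            ∎
    where open ≡-Reasoning

  *-cong-% : ∀ {a a′ b b′} → a % m ≡ a′ % m → b % m ≡ b′ % m → (a * b) % m ≡ (a′ * b′) % m
  *-cong-% {a} {a′} {b} {b′} a≡a′ b≡b′ = begin
    (a * b) % m              ≡⟨ %-distribˡ-* a b m ⟩
    (a % m * (b % m)) % m    ≡⟨ cong₂ (λ x y → (x * y) % m) a≡a′ b≡b′ ⟩
    (a′ % m * (b′ % m)) % m  ≡⟨ %-distribˡ-* a′ b′ m ⟨
    (a′ * b′) % m            ∎
    where open ≡-Reasoning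

  ^-cong-% : ∀ {a a′} → a % m ≡ a′ % m → ∀ j → (a ℕ.^ j) % m ≡ (a′ ℕ.^ j) % m
  ^-cong-% a≡a′ zero    = refl
  ^-cong-% a≡a′ (suc j) = *-cong-% a≡a′ (^-cong-% a≡a′ j)

  mod-cong : ∀ {a b} → a % m ≡ b % m → a mod m ≡ b mod m
  mod-cong {a} {b} eq = Fin.fromℕ<-cong _ _ eq (m%n<n a m) (m%n<n b m)

module _ {m n : ℕ} .{{_ : NonZero m}} .{{_ : NonZero n}} where
  open import Data.Nat using (_+_)

  Meta-≅ : ∀ {t t′ r r′} → t % m ≡ t′ % m → r % m ≡ r′ % m → Meta m n t r ≅ Meta m n t′ r′
  Meta-≅ {t} {t′} {r} {r′} t≡t′ r≡r′ = id , bijective _≡_ , same-product , refl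
    where
    module M = RawMonoid (Meta m n t r)
    module M′ = RawMonoid (Meta m n t′ r′)
    same-product : ∀ x y → x M.∙ y ≡ x M′.∙ y
    same-product (i , j) (k , l) = cong (_, _) (mod-cong
      (+-cong-% (+-cong-% {a = toℕ i} refl (*-cong-% {a = toℕ k} refl (^-cong-% r≡r′ (toℕ j))))
                (*-cong-% {a = (toℕ j + toℕ l) / n} refl t≡t′)))

Dihedral : (m : ℕ) .{{_ : NonZero m}} → RawMonoid 0ℓ 0ℓ
Dihedral m = Meta m 2 0 (m ∸ 1)

Dihedral-¬embeds : ∀ m .{{_ : NonZero m}} → 2 ≤ m → ¬ EmbedsInDivisionRing (Dihedral m)
Dihedral-¬embeds (suc zero) (s≤s ())
Dihedral-¬embeds m@(suc (suc n)) _ = two-involutions⇒¬embeds {x = b} {y = ab} ≡.refl ab²≡ε (λ ()) (λ ()) (λ ())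
  where
  open RawMonoid (Dihedral m)
  b ab : Carrier
  b = zero , suc zero
  ab = suc zero , suc zero
  1+1*[m∸1]≡m : 1 ℕ.+ 1 ℕ.* (m ∸ 1) ℕ.^ 1 ℕ.+ 1 ℕ.* 0 ≡ m
  1+1*[m∸1]≡m = solve 1 (λ n → con 1 :+ con 1 :* (con 1 :+ n) :^ 1 :+ con 1 :* con 0 := con 2 :+ n) refl n
    where open ℕ-Solver
  ab²≡ε : ab ∙ ab ≡ ε
  ab²≡ε = cong (_, zero) (mod-cong {a = 1 ℕ.+ 1 ℕ.* (m ∸ 1) ℕ.^ 1 ℕ.+ 1 ℕ.* 0} {b = 0}
    (≡.trans (cong (_% m) 1+1*[m∸1]≡m) (n%n≡0 m)))

-- G_{12,5} is C₃ ⋊ C₈ with w = a⁴ and c = b² = a³.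
G₁₂,₅-¬embeds : ¬ EmbedsInDivisionRing (G 12 5)
G₁₂,₅-¬embeds (D , embedding) = ¬C₃⋊C₈ b²≈c c²≈-1 w³≈1 (image≉1 (λ ())) cw≈wc bw≈w²b
  where
  open Ring (DivisionRing.ring D) hiding (zero)
  open DivisionRingProperties D
  open EmbeddingProperties D embedding
  b c w : Carrier
  b = f (zero , suc zero)
  c = f (Fin.# 3 , zero)
  w = f (Fin.# 4 , zero)
  b²≈c : b * b ≈ c
  b²≈c = image-∙ ≡.refl
  c²≈-1 : c * c ≈ - 1#
  c²≈-1 = trans (image-∙ ≡.refl) (image-involution {Fin.# 6 , zero} ≡.refl (λ ()))
  w³≈1 : w * (w * w) ≈ 1#
  w³≈1 = trans (*-congˡ (image-∙ ≡.refl)) (trans (image-∙ ≡.refl) image-ε)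
  cw≈wc : c * w ≈ w * c
  cw≈wc = trans (image-∙ ≡.refl) (sym (image-∙ ≡.refl))
  bw≈w²b : b * w ≈ (w * w) * b
  bw≈w²b = trans (image-∙ ≡.refl) (sym (trans (*-congʳ (image-∙ ≡.refl)) (image-∙ ≡.refl)))

module QuaternionEmbeddings where
  open Quaternion using (ℍ; ⟨_,_,_,_⟩; ℚ[√5]; _*_; _^_; 𝐤; _≟_; divisionRing)

  private
    ¼ : ℚ
    ¼ = + 1 ℚ./ 4

    -- Unit quaternions of orders 6 and 10 (real parts cos(π/3) and cos(π/5)) whose pure parts
    -- anticommute with 𝐤, so that 𝐤 inverts them.
    α₁₂ α₂₀ : ℍ ℚ[√5]
    α₁₂ = ⟨ (ℚ.½ , 0ℚ) , (¼ , ¼) , (ℚ.- ¼ , ¼) , (0ℚ , 0ℚ) ⟩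
    α₂₀ = ⟨ (¼ , ¼) , (ℚ.- ¼ , ¼) , (ℚ.½ , 0ℚ) , (0ℚ , 0ℚ) ⟩

    all×? : ∀ {m n} {P : Fin m × Fin n → Set} → (∀ x → Dec (P x)) → Dec (∀ x → P x)
    all×? P? = map′ (λ h (i , j) → h i j) (λ h i j → h (i , j)) (Fin.all? λ i → Fin.all? λ j → P? (i , j))

    -- Tabulating lets the exhaustive checks below compute each image only once.
    tabulated : ∀ {m n} {A : Set} → (Fin m × Fin n → A) → Fin m × Fin n → A
    tabulated {m} {n} {A} g = lookup² (tabulate λ i → tabulate λ j → g (i , j))
      where
      lookup² : Vec (Vec A n) m → Fin m × Fin n → A
      lookup² T (i , j) = lookup (lookup T i) j

  Z4↪ℍ : EmbeddingInto Z4 divisionRing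
  Z4↪ℍ = Z.embedding f (from-yes (Z.isEmbedding? f))
    where
    module Z = FiniteEmbedding Z4 divisionRing Fin.all? Fin._≟_ _≟_
    f = λ i → 𝐤 ^ toℕ i

  Dic12↪ℍ : EmbeddingInto Dic12 divisionRing
  Dic12↪ℍ = Dic.embedding f (from-yes (Dic.isEmbedding? f))
    where
    module Dic = FiniteEmbedding Dic12 divisionRing all×? (≡-dec Fin._≟_ Fin._≟_) _≟_
    f = tabulated λ (i , j) → α₁₂ ^ toℕ i * 𝐤 ^ toℕ j

  Dic20↪ℍ : EmbeddingInto Dic20 divisionRing
  Dic20↪ℍ = Dic.embedding f (from-yes (Dic.isEmbedding? f))
    where
    module Dic = FiniteEmbedding Dic20 divisionRing all×? (≡-dec Fin._≟_ Fin._≟_) _≟_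
    f = tabulated λ (i , j) → α₂₀ ^ toℕ i * 𝐤 ^ toℕ j

open QuaternionEmbeddings using (Z4↪ℍ; Dic12↪ℍ; Dic20↪ℍ)

Classified : RawMonoid 0ℓ 0ℓ → Set
Classified A = (A ≅ Z4) ⊎ (A ≅ Dic12) ⊎ (A ≅ Dic20)

classified⇒embeds : ∀ {A} → Classified A → EmbedsInDivisionRing A
classified⇒embeds (inj₁ A≅Z4)           = embeds-along-≅ {B = Z4} id A≅Z4 (Quaternion.divisionRing , Z4↪ℍ)
classified⇒embeds (inj₂ (inj₁ A≅Dic12)) = embeds-along-≅ {B = Dic12} id A≅Dic12 (Quaternion.divisionRing , Dic12↪ℍ)
classified⇒embeds (inj₂ (inj₂ A≅Dic20)) = embeds-along-≅ {B = Dic20} id A≅Dic20 (Quaternion.divisionRing , Dic20↪ℍ)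

EmbedsIffClassified : RawMonoid 0ℓ 0ℓ → Set₁
EmbedsIffClassified A = (EmbedsInDivisionRing A → Classified A) × (Classified A → EmbedsInDivisionRing A)

¬embeds⇒iff : ∀ {A} → ¬ EmbedsInDivisionRing A → EmbedsIffClassified A
¬embeds⇒iff ¬embeds = ⊥-elim ∘′ ¬embeds , ⊥-elim ∘′ ¬embeds ∘′ classified⇒embeds

classified⇒iff : ∀ {A} → Classified A → EmbedsIffClassified A
classified⇒iff classified = (λ _ → classified) , classified⇒embeds

-- Reduction modulo m

gcd[m+kn,n]≡gcd[m,n] : ∀ m k n → gcd (m ℕ.+ k ℕ.* n) n ≡ gcd m n
gcd[m+kn,n]≡gcd[m,n] m k n = GCD.unique (gcd-GCD (m + k * n) n) (GCD.is (d∣m+kn , gcd[m,n]∣n m n) greatest)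
  where
  open import Data.Nat using (_+_; _*_)
  d∣m+kn : gcd m n ∣ m + k * n
  d∣m+kn = ∣m∣n⇒∣m+n (gcd[m,n]∣m m n) (∣n⇒∣m*n k (gcd[m,n]∣n m n))
  greatest : ∀ {d} → (d ∣ m + k * n) × (d ∣ n) → d ∣ gcd m n
  greatest {d} (d∣m+kn , d∣n) = gcd-greatest (∣m+n∣m⇒∣n (subst (d ∣_) (ℕ.+-comm m (k * n)) d∣m+kn) (∣n⇒∣m*n k d∣n)) d∣n

sOf-nonZero : ∀ m r .{{_ : NonZero m}} → NonZero (sOf m r)
sOf-nonZero m r = ℕ.≢-nonZero (gcd[m,n]≢0 (r ∸ 1) m (inj₂ (ℕ.≢-nonZero⁻¹ m)))

module _ {m : ℕ} .{{_ : NonZero m}} {r : ℕ} (1≤r%m : 1 ≤ r % m) where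

  sOf-residue : sOf m r ≡ sOf m (r % m)
  sOf-residue = begin
    gcd (r ∸ 1) m                            ≡⟨ cong (λ x → gcd (x ∸ 1) m) (m≡m%n+[m/n]*n r m) ⟩
    gcd (r % m ℕ.+ (r / m) ℕ.* m ∸ 1) m      ≡⟨ cong (λ x → gcd x m) (ℕ.+-∸-comm ((r / m) ℕ.* m) 1≤r%m) ⟩
    gcd (r % m ∸ 1 ℕ.+ (r / m) ℕ.* m) m      ≡⟨ gcd[m+kn,n]≡gcd[m,n] (r % m ∸ 1) (r / m) m ⟩
    gcd (r % m ∸ 1) m                        ∎
    where open ≡-Reasoning

  tOf-residue : tOf m r ≡ tOf m (r % m)
  tOf-residue = /-congʳ {{sOf-nonZero m r}} {{sOf-nonZero m (r % m)}} sOf-residue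

OrderTwo : (m k : ℕ) .{{_ : NonZero m}} → Set
OrderTwo m k = (k ℕ.^ 2) % m ≡ 1 % m × ¬ (k ℕ.^ 1) % m ≡ 1 % m

Admissible : (m k : ℕ) .{{_ : NonZero m}} → Set
Admissible m k = (tOf m k % m ≡ 0 × k ≡ m ∸ 1) ⊎ (m ≡ 6 × k ≡ 5) ⊎ (m ≡ 10 × k ≡ 9) ⊎ (m ≡ 12 × k ≡ 5)

AdmissibleResidues : ℕ → Set
AdmissibleResidues m′ = ∀ (k : Fin (suc m′)) → let m = suc m′; r = toℕ k in
  OrderTwo m r → gcd 2 (tOf m r) ≡ 1 → Admissible m r

admissible-residues : ∀ m′ → m′ < 12 → AdmissibleResidues m′
admissible-residues m′ m′<12 = subst AdmissibleResidues (Fin.toℕ-fromℕ< m′<12) (checked (fromℕ< m′<12))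
  where
  admissible-residues? : ∀ m′ → Dec (AdmissibleResidues m′)
  admissible-residues? m′ = Fin.all? λ k → let m = suc m′; r = toℕ k in
    (((r ℕ.^ 2) % m ℕ.≟ 1 % m) ×-dec ¬? ((r ℕ.^ 1) % m ℕ.≟ 1 % m)) →-dec (gcd 2 (tOf m r) ℕ.≟ 1) →-dec
    (((tOf m r % m ℕ.≟ 0) ×-dec (r ℕ.≟ m ∸ 1)) ⊎-dec ((m ℕ.≟ 6) ×-dec (r ℕ.≟ 5))
      ⊎-dec ((m ℕ.≟ 10) ×-dec (r ℕ.≟ 9)) ⊎-dec ((m ℕ.≟ 12) ×-dec (r ℕ.≟ 5)))
  checked : ∀ (i : Fin 12) → AdmissibleResidues (toℕ i)
  checked = from-yes (Fin.all? {12} λ i → admissible-residues? (toℕ i))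

G≅Meta : ∀ {m r t k} .{{_ : NonZero m}} → 1 ≤ r % m → tOf m (r % m) % m ≡ t % m → r % m ≡ k →
         (G m r ≅ Meta m 2 t k) × (Meta m 2 t k ≅ G m r)
G≅Meta {m} {r} 1≤r%m t-eq k-eq = Meta-≅ t≡t′ r≡k , Meta-≅ (≡.sym t≡t′) (≡.sym r≡k)
  where
  t≡t′ = ≡.trans (cong (_% m) (tOf-residue {r = r} 1≤r%m)) t-eq
  r≡k = ≡.trans (≡.sym (m%n%n≡m%n r m)) (cong (_% m) k-eq)

order-two⇒1≤ : ∀ {m k} .{{_ : NonZero m}} → 2 ≤ m → OrderTwo m k → 1 ≤ k
order-two⇒1≤ {suc zero}     (s≤s ())
order-two⇒1≤ {suc (suc _)} {zero} _ (() , _)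
order-two⇒1≤ {k = suc _}    _ _ = s≤s z≤n

residue-admissible : ∀ {m r} .{{_ : NonZero m}} → 2 ≤ m → m ≤ 12 → IsMultOrder m r 2 → gcd 2 (tOf m r) ≡ 1 →
                     1 ≤ r % m × Admissible m (r % m)
residue-admissible {m@(suc m′)} {r} 2≤m m′<12 (_ , r²≡1 , r≢1) gcd[2,t]≡1 =
  1≤r%m , classified order-two (≡.trans (cong (gcd 2) (≡.sym (tOf-residue {r = r} 1≤r%m))) gcd[2,t]≡1)
  where
  r%m≡r : ∀ j → ((r % m) ℕ.^ j) % m ≡ (r ℕ.^ j) % m
  r%m≡r = ^-cong-% (m%n%n≡m%n r m)
  order-two : OrderTwo m (r % m)
  order-two = ≡.trans (r%m≡r 2) r²≡1 , λ r%m≡1 → r≢1 1 (s≤s z≤n) (s≤s (s≤s z≤n)) (≡.trans (≡.sym (r%m≡r 1)) r%m≡1)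
  1≤r%m = order-two⇒1≤ 2≤m order-two
  classified : OrderTwo m (r % m) → gcd 2 (tOf m (r % m)) ≡ 1 → Admissible m (r % m)
  classified = subst (λ k → OrderTwo m k → gcd 2 (tOf m k) ≡ 1 → Admissible m k)
    (Fin.toℕ-fromℕ< (m%n<n r m)) (admissible-residues m′ m′<12 (r mod m))

lemma5p7 : (m r : ℕ) .{{_ : NonZero m}} →
    2 ≤ m → m ≤ 12 → 1 ≤ r → gcd m r ≡ 1 →
    IsMultOrder m r 2 →
    gcd 2 (tOf m r) ≡ 1 → gcd (sOf m r) (tOf m r) ≡ 1 →
    (EmbedsInDivisionRing (G m r) → (G m r ≅ Z4) ⊎ (G m r ≅ Dic12) ⊎ (G m r ≅ Dic20))
      × ((G m r ≅ Z4) ⊎ (G m r ≅ Dic12) ⊎ (G m r ≅ Dic20) → EmbedsInDivisionRing (G m r))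
lemma5p7 m r 2≤m m≤12 _ _ order-two gcd[2,t]≡1 _
  with 1≤r%m , admissible ← residue-admissible 2≤m m≤12 order-two gcd[2,t]≡1
  with admissible
... | inj₁ (t≡0 , r%m≡m-1) = ¬embeds⇒iff (Dihedral-¬embeds m 2≤m ∘′ embeds-along-≅ id
        (proj₂ (G≅Meta 1≤r%m (≡.trans t≡0 (≡.sym (m*n%n≡0 0 m))) r%m≡m-1)))
... | inj₂ (inj₁ (refl , r%6≡5)) =
  classified⇒iff (inj₂ (inj₁ (proj₁ (G≅Meta 1≤r%m (cong (λ k → tOf 6 k % 6) r%6≡5) r%6≡5))))
... | inj₂ (inj₂ (inj₁ (refl , r%10≡9))) =
  classified⇒iff (inj₂ (inj₂ (proj₁ (G≅Meta 1≤r%m (cong (λ k → tOf 10 k % 10) r%10≡9) r%10≡9))))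
... | inj₂ (inj₂ (inj₂ (refl , r%12≡5))) = ¬embeds⇒iff (G₁₂,₅-¬embeds ∘′ embeds-along-≅ id
        (proj₂ (G≅Meta 1≤r%m (cong (λ k → tOf 12 k % 12) r%12≡5) r%12≡5)))
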